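{- Let $\mathbb K$ be a field and $L$ an oriented linear graph satisfying property $D(2)$. Let $A_{k_1},\dots,A_{k_h}$ be the connected components of the reduction $\mathrm{Red}\,L$, ordered by their minimal-index vertex. If $k_h\equiv 1\pmod 3$, then $\mathrm{H}^*_\mu(L;\mathbb K)=0$.
   Context: An oriented linear graph $L$ is a digraph with vertices $v_0,\dots,v_{n-1}$ such that for each $i=1,\dots,n-1$ exactly one of $(v_i,v_{i-1})$, $(v_{i-1},v_i)$ is an edge, and there are no other edges. $A_k$ denotes the alternating linear graph on $k+1$ vertices (consecutive edges oppositely oriented). A vertex is unstable if it is both the source of some edge and the target of some edge, and stable otherwise. For vertices $v,w$, $d(v,w)$ is the length of the (unique) directed simple path from one to the other if it exists, and $-\infty$ otherwise. $L$ satisfies $D(k)$ if $d(v,w)\le k$ for all stable vertices $v,w$. The reduction $\mathrm{Red}\,L$ is the spanning subgraph obtained as follows: for each maximal directed simple path in $L$, with vertex set $\{v_j,\dots,v_{j+m}\}$ ordered by index, delete all its edges except the one between $v_{j+m-1}$ and $v_{j+m}$. Each connected component of $\mathrm{Red}\,L$ is isomorphic to some $A_{k}$, $k\ge 0$. A multipath of a digraph is a spanning subgraph each of whose connected components is a single vertex or a simple directed path. Multipath cohomology $\mathrm{H}^*_\mu(G;\mathbb K)$ is the cohomology of the complex whose degree $n$ part has basis $b_H$ for multipaths $H$ with $n$ edges, with $d b_H=\sum_e(-1)^{\epsilon(H,H\cup e)}b_{H\cup e}$ over edges $e\notin H$ with $H\cup e$ a multipath, $\epsilon(H,H\cup e)$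 = number of edges of $H$ preceding $e$ in a fixed total order of $E(G)$. -}

module Defs where

open import Level using (Level; _⊔_)
open import Data.Bool using (Bool; true; false; if_then_else_; not; _∧_; _∨_)
open import Data.Bool.Properties using () renaming (_≟_ to _≟ᵇ_)
open import Data.Nat using (ℕ; zero; suc; _≤_; _<_; _∸_; _%_)
open import Data.Fin using (Fin; toℕ; inject₁) renaming (zero to fzero; suc to fsuc)
open import Data.Fin.Subset using (Subset; inside; outside; _∈_; ∣_∣)
open import Data.Vec using (Vec; []; _∷_; lookup; _[_]≔_)
open import Data.List using (List; []; _∷_)
open import Data.Maybe using (Maybe; just; nothing)
open import Data.Product using (Σ; ∃; _×_; _,_)
open import Relation.Nullary using (¬_; does)
open import Relation.Binary.PropositionalEquality using (_≡_)
open import Algebra.Bundles using (CommutativeRing)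

record Field (c ℓ : Level) : Set (Level.suc (c ⊔ ℓ)) where
  field
    commutativeRing : CommutativeRing c ℓ
  open CommutativeRing commutativeRing public
  field
    0≉1     : ¬ (0# ≈ 1#)
    inverse : ∀ x → ¬ (x ≈ 0#) → ∃ λ y → x * y ≈ 1#

-- An oriented linear graph with k edges has vertices v_0,…,v_k
-- (Fin (suc k)) and edges e_0,…,e_{k-1} (Fin k); edge e_i joins
-- v_i and v_{i+1}.  It is given by an orientation vector o : Vec Bool k:
--   lookup o i ≡ true   means  e_i = (v_i , v_{i+1})
--   lookup o i ≡ false  means  e_i = (v_{i+1} , v_i)

LinGraph : ℕ → Set
LinGraph k = Vec Bool k

module _ {k : ℕ} (o : LinGraph k) where

  src : Fin k → Fin (suc k)
  src i = if lookup o i then inject₁ i else fsuc i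

  tgt : Fin k → Fin (suc k)
  tgt i = if lookup o i then fsuc i else inject₁ i

  Unstable : Fin (suc k) → Set
  Unstable v = (∃ λ e → src e ≡ v) × (∃ λ e → tgt e ≡ v)

  Stable : Fin (suc k) → Set
  Stable v = ¬ Unstable v

  -- there is a directed simple path between v and w (toℕ v ≤ toℕ w):
  -- all edges strictly between them have the same orientation
  DirPath : Fin (suc k) → Fin (suc k) → Set
  DirPath v w = ∃ λ b → ∀ (e : Fin k) → toℕ v ≤ toℕ e → toℕ e < toℕ w → lookup o e ≡ b

  -- property D(n): d(v,w) ≤ n for all stable v, w
  -- (d(v,w) = |v - w| if a directed path exists, -∞ otherwise)
  D : ℕ → Set
  D n = ∀ (v w : Fin (suc k)) → toℕ v ≤ toℕ w → Stable v → Stable w →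
        DirPath v w → toℕ w ∸ toℕ v ≤ n

  -- multipath: spanning subgraph (edge subset) whose components are
  -- isolated vertices or directed simple paths; in a linear graph this
  -- means no vertex is the source of two edges of H nor the target of
  -- two edges of H.
  IsMultipath : Subset k → Set
  IsMultipath H = ∀ (e e' : Fin k) → e ∈ H → e' ∈ H →
                  (src e ≡ src e' → e ≡ e') × (tgt e ≡ tgt e' → e ≡ e')

-- Reduction.
-- keptEdges o lists, for each edge e_0,…,e_{k-1} in order, whether it
-- survives in Red L: an edge survives iff it is the last edge of the
-- maximal directed path (maximal run of equally oriented consecutive
-- edges) containing it, i.e. it is the last edge of L or the next edge
-- has the opposite orientation.

keptEdges : ∀ {k} → LinGraph k → List Bool
keptEdges []                = []
keptEdges (b ∷ [])          = true ∷ []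
keptEdges (b ∷ b' ∷ bs)     = not (does (b ≟ᵇ b')) ∷ keptEdges (b' ∷ bs)

-- sizes (numbers of edges) of the connected components of the spanning
-- subgraph of the path v_0 - … - v_k keeping the flagged edges,
-- listed in order of their minimal vertex index; c = edges so far in
-- the current component.
componentSizes : ℕ → List Bool → List ℕ
componentSizes c []            = c ∷ []
componentSizes c (true ∷ bs)   = componentSizes (suc c) bs
componentSizes c (false ∷ bs)  = c ∷ componentSizes zero bs

-- the list k_1,…,k_h with Red L ≅ A_{k_1} ⊔ … ⊔ A_{k_h}
redComponents : ∀ {k} → LinGraph k → List ℕ
redComponents o = componentSizes zero (keptEdges o)

lastElem : List ℕ → Maybe ℕ
lastElem []           = nothing
lastElem (x ∷ [])     = just x
lastElem (x ∷ y ∷ xs) = lastElem (y ∷ xs)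

-- Multipath cochain complex.  Edges are totally ordered by index.
-- A cochain is a function Subset k → K; in degree m only its values on
-- multipaths with m edges matter.

module Multipath {c ℓ : Level} (F : Field c ℓ) where
  open Field F

  sumFin : ∀ {n} → (Fin n → Carrier) → Carrier
  sumFin {zero}  f = 0#
  sumFin {suc n} f = f fzero + sumFin (λ i → f (fsuc i))

  signPow : ℕ → Carrier → Carrier
  signPow zero    x = x
  signPow (suc n) x = - signPow n x

  precCount : ∀ {k} → Subset k → Fin k → ℕ
  precCount {k} H e = ∣ Data.Vec.tabulate (λ (f : Fin k) → if does (toℕ f Data.Nat.<? toℕ e) then lookup H f else outside) ∣
    where import Data.Vec

  δ : ∀ {k} → (Subset k → Carrier) → (Subset k → Carrier)
  δ b H = sumFin (λ e → if lookup H e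
                          then signPow (precCount H e) (b (H [ e ]≔ outside))
                          else 0#)

  AcyclicMultipath : ∀ {k} → LinGraph k → Set (c ⊔ ℓ)
  AcyclicMultipath {k} o =
    ∀ (m : ℕ) (z : Subset k → Carrier) →
    (∀ H → IsMultipath o H → ∣ H ∣ ≡ suc m → δ z H ≈ 0#) →
    ∃ λ (b : Subset k → Carrier) →
      ∀ H → IsMultipath o H → ∣ H ∣ ≡ m → z H ≈ δ b H

-- Split the multipath complex along the first edge e₀: a multipath either avoids
-- e₀, or contains it and then avoids e₁ unless e₀ and e₁ point the same way.  If
-- they do, e₀ can be added to every multipath avoiding it, the complex is the cone
-- of an isomorphism and is acyclic.  If they point opposite ways, the complex is
-- the mapping cone of restriction C(L ∖ e₀) → C(L ∖ {e₀, e₁}), hence acyclic when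
-- both are; unfolding this twice, three alternating edges in front of r give an
-- acyclic complex as soon as r does, so A_k is acyclic for k ≡ 1 (mod 3).
-- Peeling L from the left, every suffix that matters either starts with a
-- repeated orientation or is the final alternating run A_{k_h}.
module Submission where

open import Defs
open import Level using (Level)
open import Function using (_∘_; const)
open import Data.Nat using (ℕ; zero; suc; _%_)
import Data.Nat.Properties as ℕ
open import Data.Bool using (Bool; true; false; if_then_else_)
open import Data.Bool.Properties using (_≟_)
open import Data.Fin using (Fin) renaming (zero to fzero; suc to fsuc)
import Data.Fin.Properties as Fin
open import Data.Fin.Subset using (Subset; _∈_; ∣_∣; outside)
open import Data.Vec using ([]; _∷_; lookup; tabulate; _[_]≔_; here; there)
open import Data.List using ([]; _∷_)
open import Data.Maybe using (just)
open import Data.Product using (∃; _×_; _,_; proj₁; proj₂)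
open import Data.Sum using (_⊎_; inj₁; inj₂)
open import Data.Empty using (⊥-elim)
open import Relation.Nullary using (yes; no)
open import Relation.Binary.PropositionalEquality
  using (_≡_; _≢_; refl; sym; trans; cong)
import Algebra.Properties.AbelianGroup as AbelianGroupProperties
import Algebra.Properties.CommutativeSemigroup as CommutativeSemigroupProperties

Compatible : ∀ {k} → LinGraph k → Fin k → Fin k → Set
Compatible o e e' = (src o e ≡ src o e' → e ≡ e') × (tgt o e ≡ tgt o e' → e ≡ e')

compatible-sym : ∀ {k} {o : LinGraph k} {e e'} → Compatible o e e' → Compatible o e' e
compatible-sym (s , t) = (sym ∘ s ∘ sym) , (sym ∘ t ∘ sym)

module _ {k : ℕ} (a : Bool) (o : LinGraph k) (e : Fin k) where

  src-suc : src (a ∷ o) (fsuc e) ≡ fsuc (src o e)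
  src-suc with lookup o e
  ... | true  = refl
  ... | false = refl

  tgt-suc : tgt (a ∷ o) (fsuc e) ≡ fsuc (tgt o e)
  tgt-suc with lookup o e
  ... | true  = refl
  ... | false = refl

module _ {k : ℕ} {a : Bool} {o : LinGraph k} {e e' : Fin k} where

  compatible-suc⁺ : Compatible o e e' → Compatible (a ∷ o) (fsuc e) (fsuc e')
  compatible-suc⁺ (s , t) =
    (λ eq → cong fsuc (s (Fin.suc-injective (trans (sym (src-suc a o e)) (trans eq (src-suc a o e')))))) ,
    (λ eq → cong fsuc (t (Fin.suc-injective (trans (sym (tgt-suc a o e)) (trans eq (tgt-suc a o e'))))))

  compatible-suc⁻ : Compatible (a ∷ o) (fsuc e) (fsuc e') → Compatible o e e'
  compatible-suc⁻ (s , t) =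
    (λ eq → Fin.suc-injective (s (trans (src-suc a o e) (trans (cong fsuc eq) (sym (src-suc a o e')))))) ,
    (λ eq → Fin.suc-injective (t (trans (tgt-suc a o e) (trans (cong fsuc eq) (sym (tgt-suc a o e'))))))

compatible-adjacent : ∀ {k} a {o : LinGraph k} → Compatible (a ∷ a ∷ o) fzero (fsuc fzero)
compatible-adjacent true  = (λ ()) , (λ ())
compatible-adjacent false = (λ ()) , (λ ())

compatible-distant : ∀ {k} a b (o : LinGraph k) e → Compatible (a ∷ b ∷ o) fzero (fsuc (fsuc e))
compatible-distant a b o e with a | lookup o e
... | true  | true  = (λ ()) , (λ ())
... | true  | false = (λ ()) , (λ ())
... | false | true  = (λ ()) , (λ ())
... | false | false = (λ ()) , (λ ())

isMultipath-tail : ∀ {k a h} {o : LinGraph k} {H} → IsMultipath (a ∷ o) (h ∷ H) → IsMultipath o H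
isMultipath-tail {a = a} {o = o} mp e e' e∈ e'∈ =
  compatible-suc⁻ {a = a} {o} (mp (fsuc e) (fsuc e') (there e∈) (there e'∈))

isMultipath-skip : ∀ {k a} {o : LinGraph k} {H} → IsMultipath o H → IsMultipath (a ∷ o) (false ∷ H)
isMultipath-skip {a = a} {o} mp (fsuc e) (fsuc e') (there e∈) (there e'∈) =
  compatible-suc⁺ {a = a} {o} (mp e e' e∈ e'∈)

compatible-first : ∀ {k a b h e} {o : LinGraph k} {H : Subset k} →
                   (h ≡ true → a ≡ b) → e ∈ (h ∷ H) → Compatible (a ∷ b ∷ o) fzero (fsuc e)
compatible-first {a = a} {o = o} orient here with orient refl
... | refl = compatible-adjacent a {o}
compatible-first {a = a} {b} {o = o} orient (there {i = e} _) = compatible-distant a b o e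

isMultipath-take : ∀ {k a b h} {o : LinGraph k} {H} → IsMultipath (b ∷ o) (h ∷ H) →
                   (h ≡ true → a ≡ b) → IsMultipath (a ∷ b ∷ o) (true ∷ h ∷ H)
isMultipath-take mp orient fzero    fzero    _          _          = const refl , const refl
isMultipath-take {o = o} mp orient fzero (fsuc e) _ (there e∈) = compatible-first {o = o} orient e∈
isMultipath-take {o = o} mp orient (fsuc e) fzero (there e∈) _ =
  compatible-sym {o = _ ∷ _ ∷ o} (compatible-first {o = o} orient e∈)
isMultipath-take {a = a} {b} {o = o} mp orient (fsuc e) (fsuc e') (there e∈) (there e'∈) =
  compatible-suc⁺ {a = a} {b ∷ o} (mp e e' e∈ e'∈)

isMultipath-orientation : ∀ {k a b} {o : LinGraph k} {H} → IsMultipath (a ∷ b ∷ o) (true ∷ true ∷ H) → a ≡ b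
isMultipath-orientation {a = true}  {true}  mp = refl
isMultipath-orientation {a = false} {false} mp = refl
isMultipath-orientation {a = true}  {false} mp with proj₂ (mp fzero (fsuc fzero) here (there here)) refl
... | ()
isMultipath-orientation {a = false} {true}  mp with proj₁ (mp fzero (fsuc fzero) here (there here)) refl
... | ()

isMultipath-single : ∀ a H → IsMultipath (a ∷ []) H
isMultipath-single a H fzero fzero _ _ = const refl , const refl

data Alternating : ∀ {k} → LinGraph k → Set where
  single : ∀ a → Alternating (a ∷ [])
  turn   : ∀ {k a b} {o : LinGraph k} → a ≢ b → Alternating (b ∷ o) → Alternating (a ∷ b ∷ o)

-- L = p ++ a ∷ a ∷ s with a ∷ s alternating of n edges, so that A_n is the last
-- component of Red L.
data RepeatThenAlternating : ∀ {k} → ℕ → LinGraph k → Set where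
  repeated : ∀ {k a} {o : LinGraph k} → Alternating (a ∷ o) → RepeatThenAlternating (suc k) (a ∷ a ∷ o)
  prepend  : ∀ {k n x} {L : LinGraph k} → RepeatThenAlternating n L → RepeatThenAlternating n (x ∷ L)

∣tabulate-outside∣≡0 : ∀ n → ∣ tabulate {n = n} (const outside) ∣ ≡ 0
∣tabulate-outside∣≡0 zero    = refl
∣tabulate-outside∣≡0 (suc n) = ∣tabulate-outside∣≡0 n

module _ {ℓ₁ ℓ₂ : Level} (K : Field ℓ₁ ℓ₂) where
  open Field K renaming (refl to ≈-refl; sym to ≈-sym; trans to ≈-trans)
  open Multipath K
  open import Relation.Binary.Reasoning.Setoid setoid
  private
    module +-AG = AbelianGroupProperties +-abelianGroup
    module +-CS = CommutativeSemigroupProperties +-commutativeSemigroup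

  precCount-first : ∀ {k} (H : Subset (suc k)) → precCount H fzero ≡ 0
  precCount-first {k} H = ∣tabulate-outside∣≡0 k

  Cochain : ℕ → Set ℓ₁
  Cochain k = Subset k → Carrier

  x-[x-y]≈y : ∀ x y → x - (x - y) ≈ y
  x-[x-y]≈y x y = begin
    x - (x - y)   ≈⟨ +-congˡ (+-AG.⁻¹-anti-homo‿- x y) ⟩
    x + (y - x)   ≈⟨ +-assoc x y (- x) ⟨
    x + y - x     ≈⟨ +-AG.xyx⁻¹≈y x y ⟩
    y             ∎

  x-0≈x : ∀ x → x - 0# ≈ x
  x-0≈x x = ≈-trans (+-congˡ +-AG.ε⁻¹≈ε) (+-identityʳ x)

  -‿distrib-- : ∀ x y → - (x - y) ≈ - x - - y
  -‿distrib-- x y = ≈-sym (+-AG.⁻¹-∙-comm x (- y))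

  signPow-sub : ∀ n x y → signPow n (x - y) ≈ signPow n x - signPow n y
  signPow-sub zero    x y = ≈-refl
  signPow-sub (suc n) x y = ≈-trans (-‿cong (signPow-sub n x y)) (-‿distrib-- _ _)

  signPow-zero : ∀ n → signPow n 0# ≈ 0#
  signPow-zero zero    = ≈-refl
  signPow-zero (suc n) = ≈-trans (-‿cong (signPow-zero n)) +-AG.ε⁻¹≈ε

  sumFin-cong : ∀ {n} {f g : Fin n → Carrier} → (∀ i → f i ≈ g i) → sumFin f ≈ sumFin g
  sumFin-cong {zero}  f≈g = ≈-refl
  sumFin-cong {suc n} f≈g = +-cong (f≈g fzero) (sumFin-cong (f≈g ∘ fsuc))

  sumFin-zero : ∀ n → sumFin {n} (const 0#) ≈ 0#
  sumFin-zero zero    = ≈-refl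
  sumFin-zero (suc n) = ≈-trans (+-identityˡ _) (sumFin-zero n)

  sumFin-neg : ∀ {n} (f : Fin n → Carrier) → sumFin (λ i → - f i) ≈ - sumFin f
  sumFin-neg {zero}  f = ≈-sym +-AG.ε⁻¹≈ε
  sumFin-neg {suc n} f = ≈-trans (+-congˡ (sumFin-neg (f ∘ fsuc))) (+-AG.⁻¹-∙-comm _ _)

  sumFin-sub : ∀ {n} (f g : Fin n → Carrier) → sumFin (λ i → f i - g i) ≈ sumFin f - sumFin g
  sumFin-sub {zero}  f g = ≈-sym (x-0≈x 0#)
  sumFin-sub {suc n} f g = begin
    (f fzero - g fzero) + sumFin (λ i → f (fsuc i) - g (fsuc i))
      ≈⟨ +-congˡ (sumFin-sub (f ∘ fsuc) (g ∘ fsuc)) ⟩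
    (f fzero - g fzero) + (sumFin (f ∘ fsuc) - sumFin (g ∘ fsuc))
      ≈⟨ +-CS.interchange _ _ _ _ ⟩
    (f fzero + sumFin (f ∘ fsuc)) + (- g fzero - sumFin (g ∘ fsuc))
      ≈⟨ +-congˡ (+-AG.⁻¹-∙-comm _ _) ⟩
    (f fzero + sumFin (f ∘ fsuc)) - (g fzero + sumFin (g ∘ fsuc))
      ∎

  face : ∀ {k} → Cochain k → Subset k → Fin k → Carrier
  face b H e = if lookup H e then signPow (precCount H e) (b (H [ e ]≔ outside)) else 0#

  δ-sub : ∀ {k} (f g : Cochain k) H → δ (λ G → f G - g G) H ≈ δ f H - δ g H
  δ-sub f g H = ≈-trans (sumFin-cong face-sub) (sumFin-sub (face f H) (face g H))
    where
    face-sub : ∀ e → face (λ G → f G - g G) H e ≈ face f H e - face g H e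
    face-sub e with lookup H e
    ... | true  = signPow-sub (precCount H e) _ _
    ... | false = ≈-sym (x-0≈x 0#)

  δ-zero : ∀ {k} (H : Subset k) → δ (const 0#) H ≈ 0#
  δ-zero {k} H = ≈-trans (sumFin-cong face-zero) (sumFin-zero k)
    where
    face-zero : ∀ e → face (const 0#) H e ≈ 0#
    face-zero e with lookup H e
    ... | true  = signPow-zero (precCount H e)
    ... | false = ≈-refl

  δ-skip : ∀ {k} (b : Cochain (suc k)) H → δ b (false ∷ H) ≈ δ (b ∘ (false ∷_)) H
  δ-skip b H = +-identityˡ _

  δ-take : ∀ {k} (b : Cochain (suc k)) H → δ b (true ∷ H) ≈ b (false ∷ H) - δ (b ∘ (true ∷_)) H
  δ-take b H = +-cong first-face (≈-trans (sumFin-cong later-face) (sumFin-neg (face (b ∘ (true ∷_)) H)))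
    where
    first-face : signPow (precCount (true ∷ H) fzero) (b (false ∷ H)) ≈ b (false ∷ H)
    first-face rewrite precCount-first (true ∷ H) = ≈-refl
    later-face : ∀ e → face b (true ∷ H) (fsuc e) ≈ - face (b ∘ (true ∷_)) H e
    later-face e with lookup H e
    ... | true  = ≈-refl
    ... | false = ≈-sym +-AG.ε⁻¹≈ε

  cocycle-take : ∀ {k} (z : Cochain (suc k)) H → δ z (true ∷ H) ≈ 0# → z (false ∷ H) ≈ δ (z ∘ (true ∷_)) H
  cocycle-take z H closed = +-AG.x∙y⁻¹≈ε⇒x≈y _ _ (≈-trans (≈-sym (δ-take z H)) closed)

  cocycle-take-skip : ∀ {k} (z : Cochain (suc (suc k))) H → δ z (true ∷ false ∷ H) ≈ 0# →
                      z (false ∷ false ∷ H) ≈ δ (λ G → z (true ∷ false ∷ G)) H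
  cocycle-take-skip z H closed = ≈-trans (cocycle-take z (false ∷ H) closed) (δ-skip (z ∘ (true ∷_)) H)

  coboundary-below : ∀ {k} {o : LinGraph k} → AcyclicMultipath o → ∀ m (w : Cochain k) →
                     (∀ G → IsMultipath o G → ∣ G ∣ ≡ m → δ w G ≈ 0#) →
                     ∃ λ c → ∀ G → IsMultipath o G → suc ∣ G ∣ ≡ m → w G ≈ δ c G
  coboundary-below acyclic zero    w _ = const 0# , λ _ _ ()
  coboundary-below acyclic (suc m) w w-closed with acyclic m w w-closed
  ... | c , c-primitive = c , λ G mp sz → c-primitive G mp (ℕ.suc-injective sz)

  acyclic-cone : ∀ {k a} {o : LinGraph k} → (∀ H → IsMultipath o H → IsMultipath (a ∷ o) (true ∷ H)) →
                 AcyclicMultipath (a ∷ o)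
  acyclic-cone {a = a} {o} take m z z-closed = β , β-primitive
    where
    β : Cochain _
    β (false ∷ G) = z (true ∷ G)
    β (true ∷ G)  = 0#
    β-primitive : ∀ H → IsMultipath (a ∷ o) H → ∣ H ∣ ≡ m → z H ≈ δ β H
    β-primitive (false ∷ G) mp sz = begin
      z (false ∷ G)        ≈⟨ cocycle-take z G (z-closed (true ∷ G) (take G (isMultipath-tail mp)) (cong suc sz)) ⟩
      δ (z ∘ (true ∷_)) G  ≈⟨ δ-skip β G ⟨
      δ β (false ∷ G)      ∎
    β-primitive (true ∷ G) _ _ = begin
      z (true ∷ G)                        ≈⟨ x-0≈x _ ⟨
      z (true ∷ G) - 0#                   ≈⟨ +-congˡ (-‿cong (δ-zero G)) ⟨
      z (true ∷ G) - δ (const 0#) G       ≈⟨ δ-take β G ⟨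
      δ β (true ∷ G)                      ∎

  acyclic-turn : ∀ {k a b} {o : LinGraph k} → a ≢ b → AcyclicMultipath (b ∷ o) → AcyclicMultipath o →
                 AcyclicMultipath (a ∷ b ∷ o)
  acyclic-turn {k} {a} {b} {o} a≢b acyclic-bo acyclic-o m z z-closed = β , β-primitive
    where
    z-skip-closed : ∀ H → IsMultipath (b ∷ o) H → ∣ H ∣ ≡ suc m → δ (z ∘ (false ∷_)) H ≈ 0#
    z-skip-closed H mp sz = ≈-trans (≈-sym (δ-skip z H)) (z-closed (false ∷ H) (isMultipath-skip mp) sz)
    c₀ : Cochain (suc k)
    c₀ = proj₁ (acyclic-bo m (z ∘ (false ∷_)) z-skip-closed)
    c₀-primitive : ∀ H → IsMultipath (b ∷ o) H → ∣ H ∣ ≡ m → z (false ∷ H) ≈ δ c₀ H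
    c₀-primitive = proj₂ (acyclic-bo m (z ∘ (false ∷_)) z-skip-closed)
    w : Cochain k
    w G = c₀ (false ∷ G) - z (true ∷ false ∷ G)
    w-closed : ∀ G → IsMultipath o G → ∣ G ∣ ≡ m → δ w G ≈ 0#
    w-closed G mp sz = begin
      δ w G
        ≈⟨ δ-sub (c₀ ∘ (false ∷_)) z-turned G ⟩
      δ (c₀ ∘ (false ∷_)) G - δ z-turned G
        ≈⟨ +-congʳ (δ-skip c₀ G) ⟨
      δ c₀ (false ∷ G) - δ z-turned G
        ≈⟨ +-congʳ (c₀-primitive (false ∷ G) (isMultipath-skip mp) sz) ⟨
      z (false ∷ false ∷ G) - δ z-turned G
        ≈⟨ +-congʳ z-turned-primitive ⟩
      δ z-turned G - δ z-turned G
        ≈⟨ -‿inverseʳ _ ⟩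
      0#
        ∎
      where
      z-turned : Cochain k
      z-turned G' = z (true ∷ false ∷ G')
      z-turned-primitive : z (false ∷ false ∷ G) ≈ δ z-turned G
      z-turned-primitive = cocycle-take-skip z G (z-closed (true ∷ false ∷ G) tf-multipath (cong suc sz))
        where
        tf-multipath : IsMultipath (a ∷ b ∷ o) (true ∷ false ∷ G)
        tf-multipath = isMultipath-take {a = a} {b} (isMultipath-skip {a = b} mp) (λ ())
    c₁ : Cochain k
    c₁ = proj₁ (coboundary-below {o = o} acyclic-o m w w-closed)
    c₁-primitive : ∀ G → IsMultipath o G → suc ∣ G ∣ ≡ m → w G ≈ δ c₁ G
    c₁-primitive = proj₂ (coboundary-below {o = o} acyclic-o m w w-closed)
    β : Cochain (suc (suc k))
    β (false ∷ H)    = c₀ H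
    β (true ∷ _ ∷ G) = c₁ G
    β-primitive : ∀ H → IsMultipath (a ∷ b ∷ o) H → ∣ H ∣ ≡ m → z H ≈ δ β H
    β-primitive (false ∷ H) mp sz = ≈-trans (c₀-primitive H (isMultipath-tail mp) sz) (≈-sym (δ-skip β H))
    β-primitive (true ∷ true ∷ G) mp _ = ⊥-elim (a≢b (isMultipath-orientation mp))
    β-primitive (true ∷ false ∷ G) mp sz = begin
      z (true ∷ false ∷ G)
        ≈⟨ x-[x-y]≈y _ _ ⟨
      c₀ (false ∷ G) - w G
        ≈⟨ +-congˡ (-‿cong (c₁-primitive G (isMultipath-tail (isMultipath-tail mp)) sz)) ⟩
      c₀ (false ∷ G) - δ c₁ G
        ≈⟨ +-congˡ (-‿cong (δ-skip (β ∘ (true ∷_)) G)) ⟨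
      c₀ (false ∷ G) - δ (β ∘ (true ∷_)) (false ∷ G)
        ≈⟨ δ-take β (false ∷ G) ⟨
      δ β (true ∷ false ∷ G)
        ∎

  acyclic-zigzag : ∀ {k a b c} {r : LinGraph k} → a ≢ b → b ≢ c → AcyclicMultipath r →
                   AcyclicMultipath (a ∷ b ∷ c ∷ r)
  acyclic-zigzag {k} {a} {b} {c} {r} a≢b b≢c acyclic-r m z z-closed = β , β-primitive
    where
    w : Cochain k
    w G = z (true ∷ false ∷ false ∷ G) - z (false ∷ true ∷ false ∷ G)
    w-closed : ∀ G → IsMultipath r G → ∣ G ∣ ≡ m → δ w G ≈ 0#
    w-closed G mp sz = begin
      δ w G
        ≈⟨ δ-sub z-tff z-ftf G ⟩
      δ z-tff G - δ z-ftf G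
        ≈⟨ +-cong (≈-sym via-tff) (-‿cong (≈-sym via-ftf)) ⟩
      z (false ∷ false ∷ false ∷ G) - z (false ∷ false ∷ false ∷ G)
        ≈⟨ -‿inverseʳ _ ⟩
      0#
        ∎
      where
      z-tff z-ftf : Cochain k
      z-tff G' = z (true ∷ false ∷ false ∷ G')
      z-ftf G' = z (false ∷ true ∷ false ∷ G')
      tff-multipath : IsMultipath (a ∷ b ∷ c ∷ r) (true ∷ false ∷ false ∷ G)
      tff-multipath = isMultipath-take {a = a} {b} (isMultipath-skip {a = b} (isMultipath-skip {a = c} mp)) (λ ())
      ftf-multipath : IsMultipath (a ∷ b ∷ c ∷ r) (false ∷ true ∷ false ∷ G)
      ftf-multipath = isMultipath-skip {a = a} (isMultipath-take {a = b} {c} (isMultipath-skip {a = c} mp) (λ ()))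
      via-tff : z (false ∷ false ∷ false ∷ G) ≈ δ z-tff G
      via-tff = ≈-trans (cocycle-take-skip z (false ∷ G) (z-closed _ tff-multipath (cong suc sz)))
                        (δ-skip (λ G' → z (true ∷ false ∷ G')) G)
      via-ftf : z (false ∷ false ∷ false ∷ G) ≈ δ z-ftf G
      via-ftf = cocycle-take-skip (z ∘ (false ∷_)) G
                  (≈-trans (≈-sym (δ-skip z (true ∷ false ∷ G))) (z-closed _ ftf-multipath (cong suc sz)))
    c₁ : Cochain k
    c₁ = proj₁ (coboundary-below {o = r} acyclic-r m w w-closed)
    c₁-primitive : ∀ G → IsMultipath r G → suc ∣ G ∣ ≡ m → w G ≈ δ c₁ G
    c₁-primitive = proj₂ (coboundary-below {o = r} acyclic-r m w w-closed)
    β : Cochain (suc (suc (suc k)))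
    β (false ∷ false ∷ G)    = z (true ∷ false ∷ G)
    β (false ∷ true ∷ _ ∷ G) = c₁ G
    β (true ∷ _)             = 0#
    β-primitive : ∀ H → IsMultipath (a ∷ b ∷ c ∷ r) H → ∣ H ∣ ≡ m → z H ≈ δ β H
    β-primitive (true ∷ true ∷ _) mp _ = ⊥-elim (a≢b (isMultipath-orientation mp))
    β-primitive (false ∷ true ∷ true ∷ _) mp _ = ⊥-elim (b≢c (isMultipath-orientation (isMultipath-tail mp)))
    β-primitive (false ∷ false ∷ G) mp sz = begin
      z (false ∷ false ∷ G)
        ≈⟨ cocycle-take-skip z G (z-closed _ tf-multipath (cong suc sz)) ⟩
      δ (λ G' → z (true ∷ false ∷ G')) G
        ≈⟨ δ-skip (β ∘ (false ∷_)) G ⟨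
      δ (β ∘ (false ∷_)) (false ∷ G)
        ≈⟨ δ-skip β (false ∷ G) ⟨
      δ β (false ∷ false ∷ G)
        ∎
      where
      tf-multipath : IsMultipath (a ∷ b ∷ c ∷ r) (true ∷ false ∷ G)
      tf-multipath = isMultipath-take {a = a} {b} (isMultipath-skip {a = b} (isMultipath-tail (isMultipath-tail mp))) (λ ())
    β-primitive (true ∷ false ∷ G) _ _ = begin
      z (true ∷ false ∷ G)
        ≈⟨ x-0≈x _ ⟨
      z (true ∷ false ∷ G) - 0#
        ≈⟨ +-congˡ (-‿cong (δ-zero (false ∷ G))) ⟨
      z (true ∷ false ∷ G) - δ (const 0#) (false ∷ G)
        ≈⟨ δ-take β (false ∷ G) ⟨
      δ β (true ∷ false ∷ G)
        ∎
    β-primitive (false ∷ true ∷ false ∷ G) mp sz = begin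
      z (false ∷ true ∷ false ∷ G)
        ≈⟨ x-[x-y]≈y _ _ ⟨
      z (true ∷ false ∷ false ∷ G) - w G
        ≈⟨ +-congˡ (-‿cong (c₁-primitive G r-multipath sz)) ⟩
      z (true ∷ false ∷ false ∷ G) - δ c₁ G
        ≈⟨ +-congˡ (-‿cong (δ-skip (λ H → β (false ∷ true ∷ H)) G)) ⟨
      z (true ∷ false ∷ false ∷ G) - δ (λ H → β (false ∷ true ∷ H)) (false ∷ G)
        ≈⟨ δ-take (β ∘ (false ∷_)) (false ∷ G) ⟨
      δ (β ∘ (false ∷_)) (true ∷ false ∷ G)
        ≈⟨ δ-skip β (true ∷ false ∷ G) ⟨
      δ β (false ∷ true ∷ false ∷ G)
        ∎
      where
      r-multipath : IsMultipath r G
      r-multipath = isMultipath-tail (isMultipath-tail (isMultipath-tail mp))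

  acyclic-single : ∀ a → AcyclicMultipath (a ∷ [])
  acyclic-single a = acyclic-cone (λ H _ → isMultipath-single a (true ∷ H))

  acyclic-repeat : ∀ {k} a (o : LinGraph k) → AcyclicMultipath (a ∷ a ∷ o)
  acyclic-repeat a o = acyclic-cone λ { (h ∷ H) mp → isMultipath-take {a = a} {a} mp (const refl) }

  acyclic-alternating : ∀ {k} {L : LinGraph k} → Alternating L → k % 3 ≡ 1 → AcyclicMultipath L
  acyclic-alternating (single a)                     _   = acyclic-single a
  acyclic-alternating (turn _ (single _))            ()
  acyclic-alternating (turn _ (turn _ (single _)))   ()
  acyclic-alternating (turn p (turn q (turn _ alt))) k%3 = acyclic-zigzag p q (acyclic-alternating alt k%3)

  acyclic-repeatThenAlternating : ∀ {k n} {L : LinGraph k} → RepeatThenAlternating n L → n % 3 ≡ 1 →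
                                  AcyclicMultipath L
  acyclic-drop-repeatThenAlternating : ∀ {k n b} {o : LinGraph k} → RepeatThenAlternating n (b ∷ o) → n % 3 ≡ 1 →
                                       AcyclicMultipath o

  acyclic-repeatThenAlternating (repeated {a = a} {o} _) _ = acyclic-repeat a o
  acyclic-repeatThenAlternating (prepend {x = x} {L = b ∷ o} r) n%3 with x ≟ b
  ... | yes refl = acyclic-repeat x o
  ... | no x≢b   = acyclic-turn x≢b (acyclic-repeatThenAlternating r n%3) (acyclic-drop-repeatThenAlternating r n%3)

  acyclic-drop-repeatThenAlternating (repeated alt) = acyclic-alternating alt
  acyclic-drop-repeatThenAlternating (prepend r)    = acyclic-repeatThenAlternating r

open import Data.Nat using (_+_)

lastElem-cons : ∀ x c bs → lastElem (x ∷ componentSizes c bs) ≡ lastElem (componentSizes c bs)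
lastElem-cons x c []           = refl
lastElem-cons x c (true ∷ bs)  = lastElem-cons x (suc c) bs
lastElem-cons x c (false ∷ bs) = refl

lastComponentSize : ∀ {k} (L : LinGraph (suc k)) c {n} → lastElem (componentSizes c (keptEdges L)) ≡ just n →
                    (Alternating L × c + suc k ≡ n) ⊎ RepeatThenAlternating n L
lastComponentSize (a ∷ []) c refl = inj₁ (single a , ℕ.+-comm c 1)
lastComponentSize (a ∷ b ∷ o) c last with a ≟ b
... | yes refl with lastComponentSize (a ∷ o) 0 (trans (sym (lastElem-cons c 0 (keptEdges (a ∷ o)))) last)
...   | inj₁ (alt , refl) = inj₂ (repeated alt)
...   | inj₂ r            = inj₂ (prepend r)
lastComponentSize (a ∷ b ∷ o) c last | no a≢b with lastComponentSize (b ∷ o) (suc c) last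
...   | inj₁ (alt , eq) = inj₁ (turn a≢b alt , trans (ℕ.+-suc c _) eq)
...   | inj₂ r          = inj₂ (prepend r)

lemma5p10 : ∀ {c ℓ : Level} (K : Field c ℓ) (k : ℕ) (L : LinGraph k) →
    ∀ (kh : ℕ) → D L 2 → lastElem (redComponents L) ≡ just kh → kh % 3 ≡ 1 →
    Multipath.AcyclicMultipath K L
lemma5p10 K zero    []  .0 _ refl ()
lemma5p10 K (suc k) L   kh _ last kh%3 with lastComponentSize L 0 last
... | inj₁ (alt , refl) = acyclic-alternating K alt kh%3
... | inj₂ r            = acyclic-repeatThenAlternating K r kh%3
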